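{- Let $H$ and $G$ be graphs and let $k\geq 1$ be an integer. If $H$ is $k$-$G$-free-minimal, then \[|V(H)|\geq (k-1)(|V(G)|-1)+1.\]
   Context: All graphs are finite, simple and undirected. For a graph $G$ on at least 2 vertices, a $G$-free $k$-colouring of a graph $H$ is a map $\pi:V(H)\to\{1,\dots,k\}$ such that for every $i$ the subgraph of $H$ induced by $\pi^{ -1}(i)$ contains no subgraph isomorphic to $G$. The $G$-free chromatic number $\chi_G(H)$ is the least $k$ for which a $G$-free $k$-colouring of $H$ exists. $H$ is $G$-free-minimal if $\chi_G(H\setminus\{e\})=\chi_G(H)-1$ for every edge $e\in E(H)$; $H$ is $k$-$G$-free-minimal if moreover $\chi_G(H)=k$. -}

module Defs where

open import Data.Nat using (ℕ; _<_; _≤_; _∸_)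
open import Data.Fin using (Fin)
open import Data.Product using (Σ; ∃; _×_; _,_; proj₁; proj₂)
open import Data.Sum using (_⊎_; inj₁; inj₂)
open import Relation.Nullary using (¬_)
open import Relation.Binary.PropositionalEquality using (_≡_)
open import Function.Definitions using (Injective)

record Graph : Set₁ where
  field
    n      : ℕ
    Adj    : Fin n → Fin n → Set
    sym    : ∀ {i j} → Adj i j → Adj j i
    irrefl : ∀ {i} → ¬ Adj i i

open Graph public

∣V∣ : Graph → ℕ
∣V∣ = Graph.n

SameEdge : ∀ {m} → Fin m → Fin m → Fin m → Fin m → Set
SameEdge i j u v = (i ≡ u × j ≡ v) ⊎ (i ≡ v × j ≡ u)

sameEdge-swap : ∀ {m} {i j u v : Fin m} → SameEdge i j u v → SameEdge j i u v
sameEdge-swap (inj₁ (a , b)) = inj₂ (b , a)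
sameEdge-swap (inj₂ (a , b)) = inj₁ (b , a)

deleteEdge : (H : Graph) → Fin (n H) → Fin (n H) → Graph
deleteEdge H u v = record
  { n      = n H
  ; Adj    = λ i j → Adj H i j × ¬ SameEdge i j u v
  ; sym    = λ { (a , ne) → Graph.sym H a , (λ s → ne (sameEdge-swap s)) }
  ; irrefl = λ a → Graph.irrefl H (proj₁ a)
  }

-- H contains a subgraph isomorphic to G inside the colour class c of π,
-- i.e. the subgraph induced by π⁻¹(c) contains a copy of G:
-- an injective vertex map f : V(G) → π⁻¹(c) sending edges to edges.
MonochromaticCopy : (G H : Graph) {k : ℕ} → (Fin (n H) → Fin k) → Fin k → Set
MonochromaticCopy G H π c =
  Σ (Fin (n G) → Fin (n H)) λ f →
    Injective _≡_ _≡_ f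
    × (∀ x → π (f x) ≡ c)
    × (∀ {x y} → Adj G x y → Adj H (f x) (f y))

IsGFreeColouring : (G H : Graph) (k : ℕ) → (Fin (n H) → Fin k) → Set
IsGFreeColouring G H k π = ∀ (c : Fin k) → ¬ MonochromaticCopy G H π c

HasGFreeColouring : (G H : Graph) (k : ℕ) → Set
HasGFreeColouring G H k = ∃ λ (π : Fin (n H) → Fin k) → IsGFreeColouring G H k π

ChiG≡ : (G H : Graph) (k : ℕ) → Set
ChiG≡ G H k = HasGFreeColouring G H k × (∀ m → m < k → ¬ HasGFreeColouring G H m)

IsKGFreeMinimal : (k : ℕ) (G H : Graph) → Set
IsKGFreeMinimal k G H =
  ChiG≡ G H k
  × (∀ (u v : Fin (n H)) → Adj H u v → ChiG≡ G (deleteEdge H u v) (k ∸ 1))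

{-# OPTIONS --safe #-}
module Submission where

-- If |V(H)| ≤ m d with d < |V(G)|, the vertices of H fit into m colour classes of at most d
-- vertices each; no class can host a copy of G, so χ_G(H) ≤ m. Applied with
-- d = |V(G)| − 1 and m = k − 1, minimality of k = χ_G(H) forces |V(H)| > (k − 1)(|V(G)| − 1).

open import Defs
open import Data.Nat using (ℕ; _≤_; _+_; _*_; _∸_; suc; _<_; _≤?_; s≤s; z≤n)
open import Data.Nat.Properties using (+-comm; ≰⇒>; ≤-refl; ≤-trans; ∸-monoʳ-<)
open import Data.Fin using (Fin; inject≤; remQuot)
open import Data.Fin.Properties using (pigeonhole; <⇒≢; inject≤-injective; *↔×)
open import Data.Empty using (⊥-elim)
open import Data.Product using (_×_; _,_; proj₁; proj₂)
open import Function using (_∘_)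
open import Function.Bundles using (Injection)
open import Function.Definitions using (Injective)
open import Function.Properties.Inverse using (Inverse⇒Injection)
open import Relation.Nullary using (yes; no)
open import Relation.Binary.PropositionalEquality using (_≡_; trans; cong₂; subst) renaming (sym to ≡-sym)

module _ (G H : Graph) {m d : ℕ} where

  isGFreeColouring-labelled : d < ∣V∣ G → (π : Fin (n H) → Fin m) (ℓ : Fin (n H) → Fin d) →
    (∀ {u v} → π u ≡ π v → ℓ u ≡ ℓ v → u ≡ v) → IsGFreeColouring G H m π
  isGFreeColouring-labelled d<∣G∣ π ℓ separates c (f , f-inj , f-colour , _)
    with i , j , i<j , ℓfi≡ℓfj ← pigeonhole d<∣G∣ (ℓ ∘ f)
    = <⇒≢ i<j (f-inj (separates (trans (f-colour i) (≡-sym (f-colour j))) ℓfi≡ℓfj))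

  hasGFreeColouring-≤* : d < ∣V∣ G → ∣V∣ H ≤ m * d → HasGFreeColouring G H m
  hasGFreeColouring-≤* d<∣G∣ ∣H∣≤md =
    proj₁ ∘ code , isGFreeColouring-labelled d<∣G∣ (proj₁ ∘ code) (proj₂ ∘ code)
      λ same-colour same-label → code-injective (cong₂ _,_ same-colour same-label)
    where
    code : Fin (n H) → Fin m × Fin d
    code = remQuot d ∘ λ v → inject≤ v ∣H∣≤md

    code-injective : Injective _≡_ _≡_ code
    code-injective = inject≤-injective ∣H∣≤md ∣H∣≤md _ _
                   ∘ Injection.injective (Inverse⇒Injection (*↔× {m} {d}))

  chiG≡suc⇒*< : ChiG≡ G H (suc m) → d < ∣V∣ G → m * d < ∣V∣ H
  chiG≡suc⇒*< (_ , no-fewer) d<∣G∣ with ∣V∣ H ≤? m * d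
  ... | yes ∣H∣≤md = ⊥-elim (no-fewer m ≤-refl (hasGFreeColouring-≤* d<∣G∣ ∣H∣≤md))
  ... | no ∣H∣≰md = ≰⇒> ∣H∣≰md

theorem14 : (G H : Graph) (k : ℕ) → 2 ≤ ∣V∣ G → 1 ≤ k →
    IsKGFreeMinimal k G H →
    (k ∸ 1) * (∣V∣ G ∸ 1) + 1 ≤ ∣V∣ H
theorem14 G H (suc m) 2≤∣G∣ _ (χ≡k , _) =
  subst (_≤ ∣V∣ H) (+-comm 1 (m * (∣V∣ G ∸ 1)))
    (chiG≡suc⇒*< G H χ≡k (∸-monoʳ-< (s≤s z≤n) (≤-trans (s≤s z≤n) 2≤∣G∣)))
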